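{- In selective compound Node-Kayles under normal play, for every $n\ge 0$ the paths $P_{5n}$ and $P_{5n+4}$ are $\mathcal{P}$-positions, and the paths $P_{5n+1}$, $P_{5n+2}$ and $P_{5n+3}$ are $\mathcal{N}$-positions. Equivalently, writing $\sigma(P)=1$ if $P$ is an $\mathcal{N}$-position and $\sigma(P)=0$ if it is a $\mathcal{P}$-position, we have $\sigma(P_{5n})=\sigma(P_{5n+4})=0$ and $\sigma(P_{5n+1})=\sigma(P_{5n+2})=\sigma(P_{5n+3})=1$.
   Context: For $n\ge 0$, $P_n$ denotes the path on $n$ vertices ($P_0$ is the empty graph). A Node-Kayles move on a path $P_k$ with $k\ge 1$ chooses a vertex and deletes it together with its neighbours. The possible results are: $P_0$ if $k\in\{1,2\}$; $P_0$ or $P_1$ if $k=3$; and, for $k\ge 4$, $P_{k-2}$, $P_{k-3}$, or two paths $P_i,P_j$ with $j\ge i\ge1$, $i+j=k-3$. Selective compound Node-Kayles is played by two players who move alternately, starting from a single path. A position is a finite multiset of paths (components). A move consists in choosing any nonempty set of nonempty components and replacing each chosen component by the result of a Node-Kayles move on it; a split component yields two components. The game ends when all components are empty (long ending rule). Under normal play, the player who made the last move wins. A position is a $\mathcal{P}$-position if the second player (the one not moving next) has a winning strategy, and an $\mathcal{N}$-position otherwise. -}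

module Defs where

open import Data.Nat using (ℕ; zero; suc; _+_; _≤_)
open import Data.List using (List; []; _∷_; _++_; [_])
open import Data.Bool using (Bool; true; false; _∨_)
open import Relation.Binary.PropositionalEquality using (_≡_)

-- A position is a finite multiset of paths, represented as a list of path
-- lengths (P_k is represented by k; P_0, the empty graph, by 0).
-- Order of the list is irrelevant for the game (moves act componentwise).
Position : Set
Position = List ℕ

-- Node-Kayles moves on a single path P_k, exactly as listed in the paper:
-- NKMove k r  means that one Node-Kayles move on P_k can produce the
-- (multiset of) components r.  (No move exists on P_0.)
data NKMove : ℕ → List ℕ → Set where
  nk1      : NKMove 1 []
  nk2      : NKMove 2 []
  nk3-0    : NKMove 3 []
  nk3-1    : NKMove 3 [ 1 ]
  -- k = m + 4 ≥ 4 : result P_{k-2}, P_{k-3}, or P_i , P_j with 1 ≤ i ≤ j, i + j = k - 3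
  nk-2     : ∀ m → NKMove (suc (suc (suc (suc m)))) [ suc (suc m) ]
  nk-3     : ∀ m → NKMove (suc (suc (suc (suc m)))) [ suc m ]
  nk-split : ∀ m i j → 1 ≤ i → i ≤ j → i + j ≡ suc m →
             NKMove (suc (suc (suc (suc m)))) (i ∷ j ∷ [])

-- Selective compound move, componentwise:  Sel b p q  means q is obtained
-- from p by replacing some set of components, each by the result of a
-- Node-Kayles move on it; b records whether at least one component was played.
data Sel : Bool → Position → Position → Set where
  done : Sel false [] []
  keep : ∀ {b x xs ys} → Sel b xs ys → Sel b (x ∷ xs) (x ∷ ys)
  play : ∀ {b x r xs ys} → NKMove x r → Sel b xs ys → Sel true (x ∷ xs) (r ++ ys)

Move : Position → Position → Set
Move p q = Sel true p q

-- Normal play outcome classes (the game is finite, so these inductive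
-- definitions capture who wins):
--   NPos p : the player to move from p has a winning strategy (N-position)
--   PPos p : every move from p leads to an N-position (P-position)
data NPos : Position → Set
data PPos : Position → Set

data NPos where
  win : ∀ {p q} → Move p q → PPos q → NPos p

data PPos where
  lose : ∀ {p} → (∀ q → Move p q → NPos q) → PPos p

-- Call a path length losing when it is ≡ 0 or 4 (mod 5).  Every Node-Kayles
-- move on a losing path leaves some winning component, and every winning path
-- has a move leaving only losing components.  Hence a position all of whose
-- components are losing is a P-position: whatever set of components the
-- opponent plays, a winning component appears, and the player answers by
-- playing every winning component to a losing one at once.
module Submission where

open import Defs
open import Data.Nat using (ℕ; zero; suc; _+_; _*_; _<_; _≤_; z≤n; s≤s)
open import Data.Nat.Properties
  using (+-identityʳ; +-assoc; *-suc; m≤n+m; n≤1+n; <⇒≤; +-monoʳ-≤; +-monoʳ-<; +-mono-≤; +-mono-<-≤)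
open import Data.Nat.ListAction using (sum)
open import Data.Nat.ListAction.Properties using (sum-++)
open import Data.Nat.Induction using (<-wellFounded)
open import Induction.WellFounded using (Acc; acc)
open import Data.List using (List; []; _∷_; _++_; [_])
open import Data.List.Relation.Unary.All using (All; []; _∷_)
open import Data.List.Relation.Unary.All.Properties using (++⁺)
open import Data.List.Relation.Unary.Any using (Any; here; there)
open import Data.List.Relation.Unary.Any.Properties using (++⁺ˡ)
open import Data.Bool using (Bool; true; false)
open import Data.Product using (_×_; _,_; ∃; ∃₂)
open import Data.Sum using (_⊎_; inj₁; inj₂)
open import Data.Empty using (⊥; ⊥-elim)
open import Relation.Nullary using (¬_)
open import Relation.Binary.PropositionalEquality using (_≡_; refl; sym; trans; cong; subst)

isLosing : ℕ → Bool
isLosing 0 = true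
isLosing 1 = false
isLosing 2 = false
isLosing 3 = false
isLosing 4 = true
isLosing (suc (suc (suc (suc (suc k))))) = isLosing k

Losing : ℕ → Set
Losing k = isLosing k ≡ true

Winning : ℕ → Set
Winning k = isLosing k ≡ false

isLosing-5*n+ : ∀ n c → isLosing (5 * n + c) ≡ isLosing c
isLosing-5*n+ zero    c = refl
isLosing-5*n+ (suc n) c =
  trans (cong isLosing (trans (cong (_+ c) (*-suc 5 n)) (+-assoc 5 (5 * n) c))) (isLosing-5*n+ n c)

losing⇒¬winning : ∀ {k} → Losing k → ¬ Winning k
losing⇒¬winning l w with () ← trans (sym l) w

losing-3+⇒winning : ∀ j → Losing (3 + j) → Winning j
losing-3+⇒winning 1 _ = refl
losing-3+⇒winning 2 _ = refl
losing-3+⇒winning (suc (suc (suc (suc (suc j))))) l = losing-3+⇒winning j l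

losing-7+⇒winning : ∀ j → Losing (7 + j) → Winning j
losing-7+⇒winning 2 _ = refl
losing-7+⇒winning 3 _ = refl
losing-7+⇒winning (suc (suc (suc (suc (suc j))))) l = losing-7+⇒winning j l

losing-3+i+j⇒winning-i⊎winning-j : ∀ i j → Losing (3 + i + j) → Winning i ⊎ Winning j
losing-3+i+j⇒winning-i⊎winning-j 0 j l = inj₂ (losing-3+⇒winning j l)
losing-3+i+j⇒winning-i⊎winning-j 1 j _ = inj₁ refl
losing-3+i+j⇒winning-i⊎winning-j 2 j _ = inj₁ refl
losing-3+i+j⇒winning-i⊎winning-j 3 j _ = inj₁ refl
losing-3+i+j⇒winning-i⊎winning-j 4 j l = inj₂ (losing-7+⇒winning j l)
losing-3+i+j⇒winning-i⊎winning-j (suc (suc (suc (suc (suc i))))) j l =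
  losing-3+i+j⇒winning-i⊎winning-j i j l

losing-4+⇒winning-2+ : ∀ m → Losing (4 + m) → Winning (2 + m)
losing-4+⇒winning-2+ 0 _ = refl
losing-4+⇒winning-2+ 1 _ = refl
losing-4+⇒winning-2+ (suc (suc (suc (suc (suc m))))) l = losing-4+⇒winning-2+ m l

losing-4+⇒winning-1+ : ∀ m → Losing (4 + m) → Winning (1 + m)
losing-4+⇒winning-1+ 0 _ = refl
losing-4+⇒winning-1+ 1 _ = refl
losing-4+⇒winning-1+ (suc (suc (suc (suc (suc m))))) l = losing-4+⇒winning-1+ m l

winning-4+⇒losing-2+⊎losing-1+ : ∀ m → Winning (4 + m) → Losing (2 + m) ⊎ Losing (1 + m)
winning-4+⇒losing-2+⊎losing-1+ 2 _ = inj₁ refl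
winning-4+⇒losing-2+⊎losing-1+ 3 _ = inj₁ refl
winning-4+⇒losing-2+⊎losing-1+ 4 _ = inj₂ refl
winning-4+⇒losing-2+⊎losing-1+ (suc (suc (suc (suc (suc m))))) w =
  winning-4+⇒losing-2+⊎losing-1+ m w

NKMove-losing⇒any-winning : ∀ {k r} → NKMove k r → Losing k → Any Winning r
NKMove-losing⇒any-winning (nk-2 m) l = here (losing-4+⇒winning-2+ m l)
NKMove-losing⇒any-winning (nk-3 m) l = here (losing-4+⇒winning-1+ m l)
NKMove-losing⇒any-winning (nk-split m i j _ _ i+j≡1+m) l
  with losing-3+i+j⇒winning-i⊎winning-j i j (subst (λ t → Losing (3 + t)) (sym i+j≡1+m) l)
... | inj₁ wi = here wi
... | inj₂ wj = there (here wj)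

winning⇒NKMove-all-losing : ∀ k → Winning k → ∃ λ r → NKMove k r × All Losing r
winning⇒NKMove-all-losing 1 _ = [] , nk1 , []
winning⇒NKMove-all-losing 2 _ = [] , nk2 , []
winning⇒NKMove-all-losing 3 _ = [] , nk3-0 , []
winning⇒NKMove-all-losing (suc (suc (suc (suc m)))) w with winning-4+⇒losing-2+⊎losing-1+ m w
... | inj₁ l = _ , nk-2 m , l ∷ []
... | inj₂ l = _ , nk-3 m , l ∷ []

NKMove-sum< : ∀ {k r} → NKMove k r → sum r < k
NKMove-sum< nk1 = s≤s z≤n
NKMove-sum< nk2 = s≤s z≤n
NKMove-sum< nk3-0 = s≤s z≤n
NKMove-sum< nk3-1 = s≤s (s≤s z≤n)
NKMove-sum< (nk-2 m) rewrite +-identityʳ m = s≤s (s≤s (s≤s (n≤1+n m)))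
NKMove-sum< (nk-3 m) rewrite +-identityʳ m = s≤s (s≤s (m≤n+m m 2))
NKMove-sum< (nk-split m i j _ _ i+j≡1+m) rewrite +-identityʳ j | i+j≡1+m = s≤s (s≤s (m≤n+m m 2))

Sel-sum≤ : ∀ {b p q} → Sel b p q → sum q ≤ sum p
Sel-sum≤ done = z≤n
Sel-sum≤ (keep {x = x} s) = +-monoʳ-≤ x (Sel-sum≤ s)
Sel-sum≤ (play {r = r} {ys = ys} m s) rewrite sum-++ r ys = +-mono-≤ (<⇒≤ (NKMove-sum< m)) (Sel-sum≤ s)

Move-sum< : ∀ {p q} → Move p q → sum q < sum p
Move-sum< (keep {x = x} s) = +-monoʳ-< x (Move-sum< s)
Move-sum< (play {r = r} {ys = ys} m s) rewrite sum-++ r ys = +-mono-<-≤ (NKMove-sum< m) (Sel-sum≤ s)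

Sel-false⇒≡ : ∀ {p q} → Sel false p q → p ≡ q
Sel-false⇒≡ done = refl
Sel-false⇒≡ (keep {x = x} s) = cong (x ∷_) (Sel-false⇒≡ s)

Move-all-losing⇒any-winning : ∀ {p q} → Move p q → All Losing p → Any Winning q
Move-all-losing⇒any-winning (keep s) (_ ∷ ls) = there (Move-all-losing⇒any-winning s ls)
Move-all-losing⇒any-winning (play m _) (l ∷ _) = ++⁺ˡ (NKMove-losing⇒any-winning m l)

Sel-all-losing : ∀ p → ∃₂ λ b q → Sel b p q × All Losing q
Sel-all-losing [] = false , [] , done , []
Sel-all-losing (x ∷ xs) with Sel-all-losing xs | isLosing x in eq
... | b , q , s , ls | true = b , x ∷ q , keep s , eq ∷ ls
... | b , q , s , ls | false with winning⇒NKMove-all-losing x eq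
...   | r , m , lr = true , r ++ q , play m s , ++⁺ lr ls

-- If no component needed playing, every component was already losing.
any-winning⇒Move-all-losing : ∀ p → Any Winning p → ∃ λ q → Move p q × All Losing q
any-winning⇒Move-all-losing p w with Sel-all-losing p
... | true  , q , s , ls = q , s , ls
... | false , q , s , ls rewrite Sel-false⇒≡ s = ⊥-elim (any-winning-contradiction w ls)
  where
    any-winning-contradiction : ∀ {xs} → Any Winning xs → All Losing xs → ⊥
    any-winning-contradiction (here {x} w′) (l ∷ _) = losing⇒¬winning {x} l w′
    any-winning-contradiction (there w′) (_ ∷ ls′) = any-winning-contradiction w′ ls′

mutual
  all-losing⇒PPos : ∀ p → Acc _<_ (sum p) → All Losing p → PPos p
  all-losing⇒PPos p (acc rec) ls =
    lose λ q mv → any-winning⇒NPos q (rec (Move-sum< mv)) (Move-all-losing⇒any-winning mv ls)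

  any-winning⇒NPos : ∀ p → Acc _<_ (sum p) → Any Winning p → NPos p
  any-winning⇒NPos p (acc rec) w with any-winning⇒Move-all-losing p w
  ... | q , mv , ls = win mv (all-losing⇒PPos q (rec (Move-sum< mv)) ls)

losing⇒PPos : ∀ k → Losing k → PPos [ k ]
losing⇒PPos k l = all-losing⇒PPos [ k ] (<-wellFounded _) (l ∷ [])

winning⇒NPos : ∀ k → Winning k → NPos [ k ]
winning⇒NPos k w = any-winning⇒NPos [ k ] (<-wellFounded _) (here w)

theorem6 : ∀ (n : ℕ) →
    PPos [ 5 * n ] × PPos [ 5 * n + 4 ] ×
    NPos [ 5 * n + 1 ] × NPos [ 5 * n + 2 ] × NPos [ 5 * n + 3 ]
theorem6 n =
  losing⇒PPos (5 * n) (subst Losing (+-identityʳ (5 * n)) (isLosing-5*n+ n 0)) ,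
  losing⇒PPos (5 * n + 4) (isLosing-5*n+ n 4) ,
  winning⇒NPos (5 * n + 1) (isLosing-5*n+ n 1) ,
  winning⇒NPos (5 * n + 2) (isLosing-5*n+ n 2) ,
  winning⇒NPos (5 * n + 3) (isLosing-5*n+ n 3)
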